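{- For every integer $r\ge 0$ and every integer $n\ge0$, $$\mathtt{Mot}(r,n)=\sum_{\lambda\in\mathtt{Mot}(n)}\binom{r+k(\lambda)-1}{k(\lambda)},$$ where $k(\lambda)$ is the number of prime Motzkin paths in the (unique) decomposition of $\lambda$ as a concatenation of prime Motzkin paths.
   Context: A Motzkin path of size $n$ is a lattice path from $(0,0)$ to $(n,0)$ with steps $U=(1,1)$, $D=(1,-1)$, $H=(1,0)$ never going below the line $y=0$; $\mathtt{Mot}(n)$ denotes the set of them (for $n=0$, only the empty path). A nonempty Motzkin path is prime if it touches the line $y=0$ only at its starting and ending points; every Motzkin path is uniquely a concatenation $\lambda=\lambda_1\circ\cdots\circ\lambda_k$ of prime Motzkin paths ($k=0$ for the empty path). The numbers $\mathtt{Mot}(r,n)$ are defined by the formal power series identity $\sum_{n\ge0}\mathtt{Mot}(r,n)x^n=\left(\frac{1-x-\sqrt{1-2x-3x^2}}{2x^2}\right)^{r}$, where $\frac{1-x-\sqrt{1-2x-3x^2}}{2x^2}=\sum_{n\ge0}|\mathtt{Mot}(n)|x^n$. -}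

module Defs where

open import Data.Nat using (ℕ; zero; suc; _+_; _*_; _∸_)
open import Data.Nat.Combinatorics using (_C_)
open import Data.Bool using (Bool; true; false; if_then_else_)
open import Data.List using (List; []; _∷_; length; map; concatMap; filterᵇ; reverse)
open import Data.Nat.ListAction using (sum)

-- Steps of a lattice path: U = (1,1), D = (1,-1), H = (1,0).
data Step : Set where
  U D H : Step

words : ℕ → List (List Step)
words zero    = [] ∷ []
words (suc n) = concatMap (λ w → (U ∷ w) ∷ (D ∷ w) ∷ (H ∷ w) ∷ []) (words n)

validFrom : ℕ → List Step → Bool
validFrom zero    []      = true
validFrom (suc h) []      = false
validFrom h       (U ∷ w) = validFrom (suc h) w
validFrom zero    (D ∷ w) = false
validFrom (suc h) (D ∷ w) = validFrom h w
validFrom h       (H ∷ w) = validFrom h w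

isMotzkin : List Step → Bool
isMotzkin = validFrom zero

Mot : ℕ → List (List Step)
Mot n = filterᵇ isMotzkin (words n)

motNum : ℕ → ℕ
motNum n = length (Mot n)

-- height after one step (height never negative on Motzkin paths)
stepH : ℕ → Step → ℕ
stepH h       U = suc h
stepH zero    D = zero
stepH (suc h) D = h
stepH h       H = h

isZero : ℕ → Bool
isZero zero    = true
isZero (suc _) = false

-- Decomposition of a path into prime pieces: cut after every return to y = 0.
-- decompGo h acc w : current height h, current (reversed) piece acc, rest w.
decompGo : ℕ → List Step → List Step → List (List Step)
decompGo h []        []      = []
decompGo h (a ∷ acc) []      = reverse (a ∷ acc) ∷ []
decompGo h acc       (s ∷ w) =
  if isZero (stepH h s)
    then reverse (s ∷ acc) ∷ decompGo zero [] w
    else decompGo (stepH h s) (s ∷ acc) w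

primeDecomposition : List Step → List (List Step)
primeDecomposition = decompGo zero []

k : List Step → ℕ
k λ′ = length (primeDecomposition λ′)

sumTo : ℕ → (ℕ → ℕ) → ℕ
sumTo zero    f = f zero
sumTo (suc n) f = sumTo n f + f (suc n)

-- Mot(r,n): coefficient of x^n in (Σ_n |Mot(n)| x^n)^r (r-fold Cauchy product).
MotR : ℕ → ℕ → ℕ
MotR zero    zero    = 1
MotR zero    (suc n) = 0
MotR (suc r) n       = sumTo n (λ i → motNum i * MotR r (n ∸ i))

-- Right-hand side: Σ_{λ ∈ Mot(n)} binom(r + k(λ) - 1, k(λ)).
-- (Natural subtraction: only matters when r = k(λ) = 0, where binom(-1,0) = 1 = 0 C 0.)
rhs : ℕ → ℕ → ℕ
rhs r n = sum (map (λ p → (r + k p ∸ 1) C k p) (Mot n))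

-- Cutting a path λ = λ₁ ∘ ⋯ ∘ λₖ at one of its k + 1 visits to the ground writes it as
-- μ ∘ ν with μ, ν Motzkin and k(ν) = j, once for each j ≤ k, and every pair (μ, ν) arises
-- exactly once.  Hence for every weight g,
--   Σᵢ |Mot(i)| · Σ_{ν ∈ Mot(n-i)} g(k ν)  =  Σ_{λ ∈ Mot(n)} Σ_{j ≤ k(λ)} g(j).
-- For g(j) = C(r+j-1, j) the hockey-stick identity turns the inner sum into C(r+k, k),
-- so the right-hand side satisfies the convolution recurrence defining Mot(r+1, n).
-- The cutting identity is proved by induction on the length, for paths that start at any
-- height h and end on the ground.
module Submission where

open import Defs
open import Data.Nat using (ℕ; zero; suc; _+_; _*_; _∸_)
open import Data.Nat.Properties
  using (+-assoc; +-identityʳ; *-identityˡ; +-suc; *-distribʳ-+; n<1+n; +-commutativeSemigroup)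
open import Data.Nat.Combinatorics using (_C_; nCk+nC[k+1]≡[n+1]C[k+1])
open import Data.Nat.Combinatorics.Specification using (k>n⇒nCk≡0)
open import Data.Nat.ListAction using (sum)
open import Data.Nat.Tactic.RingSolver using (solve-∀)
open import Algebra.Properties.CommutativeSemigroup +-commutativeSemigroup using (interchange)
open import Data.Bool using (Bool; true; false; if_then_else_)
open import Data.List using (List; []; _∷_; length; map; concatMap; filterᵇ; reverse)
open import Data.List.Properties using (map-cong)
open import Data.Product using (∃-syntax; _,_)
open import Relation.Binary.PropositionalEquality
  using (_≡_; refl; sym; trans; cong; cong₂; module ≡-Reasoning)

module _ {A : Set} where

  sum-map-+ : (f g : A → ℕ) (xs : List A) →
              sum (map (λ x → f x + g x) xs) ≡ sum (map f xs) + sum (map g xs)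
  sum-map-+ f g []       = refl
  sum-map-+ f g (x ∷ xs) =
    trans (cong (f x + g x +_) (sum-map-+ f g xs)) (interchange (f x) (g x) _ _)

  sum-map-cong : {f g : A → ℕ} → (∀ x → f x ≡ g x) → (xs : List A) →
                 sum (map f xs) ≡ sum (map g xs)
  sum-map-cong f≗g xs = cong sum (map-cong f≗g xs)

  sum-map-zero : (xs : List A) → sum (map (λ _ → 0) xs) ≡ 0
  sum-map-zero []       = refl
  sum-map-zero (_ ∷ xs) = sum-map-zero xs

  sum-map-filterᵇ : (p : A → Bool) (f : A → ℕ) (xs : List A) →
                    sum (map f (filterᵇ p xs)) ≡ sum (map (λ x → if p x then f x else 0) xs)
  sum-map-filterᵇ p f []       = refl
  sum-map-filterᵇ p f (x ∷ xs) with p x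
  ... | true  = cong (f x +_) (sum-map-filterᵇ p f xs)
  ... | false = sum-map-filterᵇ p f xs

  length-filterᵇ : (p : A → Bool) (xs : List A) →
                   length (filterᵇ p xs) ≡ sum (map (λ x → if p x then 1 else 0) xs)
  length-filterᵇ p []       = refl
  length-filterᵇ p (x ∷ xs) with p x
  ... | true  = cong suc (length-filterᵇ p xs)
  ... | false = length-filterᵇ p xs

sumTo-cong : ∀ n {f g : ℕ → ℕ} → (∀ i → f i ≡ g i) → sumTo n f ≡ sumTo n g
sumTo-cong zero    f≗g = f≗g zero
sumTo-cong (suc n) f≗g = cong₂ _+_ (sumTo-cong n f≗g) (f≗g (suc n))

sumTo-+ : ∀ n (f g : ℕ → ℕ) → sumTo n (λ i → f i + g i) ≡ sumTo n f + sumTo n g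
sumTo-+ zero    f g = refl
sumTo-+ (suc n) f g =
  trans (cong (_+ (f (suc n) + g (suc n))) (sumTo-+ n f g))
        (interchange (sumTo n f) (sumTo n g) (f (suc n)) (g (suc n)))

sumTo-suc : ∀ n (f : ℕ → ℕ) → sumTo (suc n) f ≡ f 0 + sumTo n (λ i → f (suc i))
sumTo-suc zero    f = refl
sumTo-suc (suc n) f =
  trans (cong (_+ f (suc (suc n))) (sumTo-suc n f)) (+-assoc (f 0) _ _)

infixl 7 _⋆_

_⋆_ : (ℕ → ℕ) → (ℕ → ℕ) → ℕ → ℕ
(a ⋆ b) n = sumTo n (λ i → a i * b (n ∸ i))

⋆-cong : ∀ {a a′ b b′ : ℕ → ℕ} → (∀ i → a i ≡ a′ i) → (∀ i → b i ≡ b′ i) →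
         ∀ n → (a ⋆ b) n ≡ (a′ ⋆ b′) n
⋆-cong a≗a′ b≗b′ n = sumTo-cong n (λ i → cong₂ _*_ (a≗a′ i) (b≗b′ (n ∸ i)))

⋆-distribʳ-+ : ∀ (a a′ b : ℕ → ℕ) n → ((λ i → a i + a′ i) ⋆ b) n ≡ (a ⋆ b) n + (a′ ⋆ b) n
⋆-distribʳ-+ a a′ b n =
  trans (sumTo-cong n (λ i → *-distribʳ-+ (b (n ∸ i)) (a i) (a′ i)))
        (sumTo-+ n (λ i → a i * b (n ∸ i)) (λ i → a′ i * b (n ∸ i)))

⋆-suc : ∀ (a b : ℕ → ℕ) n → (a ⋆ b) (suc n) ≡ a 0 * b (suc n) + ((λ i → a (suc i)) ⋆ b) n
⋆-suc a b n = sumTo-suc n (λ i → a i * b (suc n ∸ i))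

sumWords : ℕ → (List Step → ℕ) → ℕ
sumWords n f = sum (map f (words n))

sumWords-cong : ∀ n {f g : List Step → ℕ} → (∀ w → f w ≡ g w) → sumWords n f ≡ sumWords n g
sumWords-cong n f≗g = sum-map-cong f≗g (words n)

sumWords-split : ∀ n {f g h : List Step → ℕ} → (∀ w → f w ≡ g w + h w) →
                 sumWords n f ≡ sumWords n g + sumWords n h
sumWords-split n {g = g} {h} f≗g+h = trans (sumWords-cong n f≗g+h) (sum-map-+ g h (words n))

sumWords-suc : ∀ n (f : List Step → ℕ) →
               sumWords (suc n) f ≡
               sumWords n (λ w → f (U ∷ w)) + sumWords n (λ w → f (D ∷ w))
                 + sumWords n (λ w → f (H ∷ w))
sumWords-suc n f =
  trans (extend (words n))
        (trans (sum-map-+ (λ w → f (U ∷ w) + f (D ∷ w)) (λ w → f (H ∷ w)) (words n))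
               (cong (_+ sumWords n (λ w → f (H ∷ w)))
                     (sum-map-+ (λ w → f (U ∷ w)) (λ w → f (D ∷ w)) (words n))))
  where
  extend : ∀ ws → sum (map f (concatMap (λ w → (U ∷ w) ∷ (D ∷ w) ∷ (H ∷ w) ∷ []) ws)) ≡
                  sum (map (λ w → f (U ∷ w) + f (D ∷ w) + f (H ∷ w)) ws)
  extend []       = refl
  extend (w ∷ ws) = trans (cong (λ t → f (U ∷ w) + (f (D ∷ w) + (f (H ∷ w) + t))) (extend ws))
                          (regroup (f (U ∷ w)) (f (D ∷ w)) (f (H ∷ w)) _)
    where
    regroup : ∀ a b c t → a + (b + (c + t)) ≡ a + b + c + t
    regroup = solve-∀

returns : ℕ → List Step → ℕ
returns h []      = 0
returns h (s ∷ w) = if isZero (stepH h s) then suc (returns zero w) else returns (stepH h s) w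

decompGo-∷ : ∀ h acc s w →
             decompGo h acc (s ∷ w) ≡
             (if isZero (stepH h s) then reverse (s ∷ acc) ∷ decompGo zero [] w
                                    else decompGo (stepH h s) (s ∷ acc) w)
decompGo-∷ h []        s w = refl
decompGo-∷ h (a ∷ acc) s w = refl

mutual
  k≡returns : ∀ w → isMotzkin w ≡ true → k w ≡ returns zero w
  k≡returns []      valid = refl
  k≡returns (U ∷ w) valid = length-decompGo-above 0 (U ∷ []) w valid
  k≡returns (H ∷ w) valid = cong suc (k≡returns w valid)

  length-decompGo-above : ∀ h acc w → validFrom (suc h) w ≡ true →
                          length (decompGo (suc h) acc w) ≡ returns (suc h) w
  length-decompGo-above h acc (U ∷ w) valid =
    trans (cong length (decompGo-∷ (suc h) acc U w)) (length-decompGo-above (suc h) (U ∷ acc) w valid)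
  length-decompGo-above zero acc (D ∷ w) valid =
    trans (cong length (decompGo-∷ 1 acc D w)) (cong suc (k≡returns w valid))
  length-decompGo-above (suc h) acc (D ∷ w) valid =
    trans (cong length (decompGo-∷ (suc (suc h)) acc D w)) (length-decompGo-above h (D ∷ acc) w valid)
  length-decompGo-above h acc (H ∷ w) valid =
    trans (cong length (decompGo-∷ (suc h) acc H w)) (length-decompGo-above h (H ∷ acc) w valid)

returns-nonempty : ∀ h s w → validFrom h (s ∷ w) ≡ true → ∃[ j ] returns h (s ∷ w) ≡ suc j
returns-nonempty zero          U (s ∷ w) valid = returns-nonempty 1 s w valid
returns-nonempty zero          H w       valid = _ , refl
returns-nonempty (suc zero)    D w       valid = _ , refl
returns-nonempty (suc (suc h)) D (s ∷ w) valid = returns-nonempty (suc h) s w valid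
returns-nonempty (suc h)       U (s ∷ w) valid = returns-nonempty (suc (suc h)) s w valid
returns-nonempty (suc h)       H (s ∷ w) valid = returns-nonempty (suc h) s w valid

pathCount : ℕ → ℕ → ℕ
pathCount h n = sumWords n (λ w → if validFrom h w then 1 else 0)

motNum≡pathCount : ∀ n → motNum n ≡ pathCount zero n
motNum≡pathCount n = length-filterᵇ isMotzkin (words n)

pathCount-suc-ground : ∀ n → pathCount zero (suc n) ≡ pathCount 1 n + pathCount zero n
pathCount-suc-ground n =
  trans (sumWords-suc n _)
        (cong (_+ pathCount zero n) (trans (cong (pathCount 1 n +_) (sum-map-zero (words n)))
                                           (+-identityʳ _)))

pathCount-suc : ∀ h n →
                pathCount (suc h) (suc n) ≡ pathCount (suc (suc h)) n + pathCount h n + pathCount (suc h) n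
pathCount-suc h n = sumWords-suc n _

motzkinWeight : (ℕ → ℕ) → List Step → ℕ
motzkinWeight g w = if isMotzkin w then g (returns zero w) else 0

weightedCount : (ℕ → ℕ) → ℕ → ℕ
weightedCount g n = sumWords n (motzkinWeight g)

partialSum : (ℕ → ℕ) → ℕ → ℕ
partialSum g zero    = 0
partialSum g (suc j) = partialSum g j + g j

groundStart : ℕ → ℕ
groundStart zero    = 1
groundStart (suc _) = 0

-- Σ of g (k ν) over the factorisations w = μ ∘ ν with μ from height h to the ground and ν
-- Motzkin: the cuts are the groundStart h + returns h w visits of w to the ground, and
-- the j-th cut from the end leaves ν with j prime factors.
cutWeight : (ℕ → ℕ) → ℕ → List Step → ℕ
cutWeight g h w = if validFrom h w then partialSum g (groundStart h + returns h w) else 0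

cutWeight-ground-U : ∀ g w → cutWeight g zero (U ∷ w) ≡ cutWeight g 1 w + motzkinWeight g (U ∷ w)
cutWeight-ground-U g w with validFrom 1 w
... | true  = refl
... | false = refl

cutWeight-ground-H : ∀ g w → cutWeight g zero (H ∷ w) ≡ cutWeight g zero w + motzkinWeight g (H ∷ w)
cutWeight-ground-H g w with validFrom zero w
... | true  = refl
... | false = refl

cutWeight-D : ∀ g h w → cutWeight g (suc h) (D ∷ w) ≡ cutWeight g h w
cutWeight-D g zero    w = refl
cutWeight-D g (suc h) w = refl

sumWords-cutWeight : ∀ g n h → sumWords n (cutWeight g h) ≡ (pathCount h ⋆ weightedCount g) n
sumWords-cutWeight g zero zero    = sym (+-identityʳ _)
sumWords-cutWeight g zero (suc h) = refl
sumWords-cutWeight g (suc n) zero = begin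
    sumWords (suc n) (cutWeight g 0)
  ≡⟨ sumWords-suc n (cutWeight g 0) ⟩
    sumWords n (λ w → cutWeight g 0 (U ∷ w)) + sumWords n (λ _ → 0)
      + sumWords n (λ w → cutWeight g 0 (H ∷ w))
  ≡⟨ cong₂ (λ u t → u + sumWords n (λ _ → 0) + t)
           (sumWords-split n (cutWeight-ground-U g)) (sumWords-split n (cutWeight-ground-H g)) ⟩
    (cw 1 + mw U) + sumWords n (λ _ → 0) + (cw 0 + mw H)
  ≡⟨ regroup (cw 1) (mw U) (sumWords n (λ _ → 0)) (cw 0) (mw H) ⟩
    (mw U + sumWords n (λ _ → 0) + mw H) + (cw 1 + cw 0)
  ≡⟨ cong₂ _+_ (sym (sumWords-suc n (motzkinWeight g)))
               (cong₂ _+_ (sumWords-cutWeight g n 1) (sumWords-cutWeight g n 0)) ⟩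
    weightedCount g (suc n) + ((pathCount 1 ⋆ weightedCount g) n + (pathCount 0 ⋆ weightedCount g) n)
  ≡⟨ cong₂ _+_ (sym (*-identityˡ _))
               (sym (⋆-distribʳ-+ (pathCount 1) (pathCount 0) (weightedCount g) n)) ⟩
    1 * weightedCount g (suc n) + ((λ i → pathCount 1 i + pathCount 0 i) ⋆ weightedCount g) n
  ≡⟨ cong (1 * weightedCount g (suc n) +_)
          (⋆-cong {b = weightedCount g} (λ i → sym (pathCount-suc-ground i)) (λ _ → refl) n) ⟩
    1 * weightedCount g (suc n) + ((λ i → pathCount 0 (suc i)) ⋆ weightedCount g) n
  ≡⟨ sym (⋆-suc (pathCount 0) (weightedCount g) n) ⟩
    (pathCount 0 ⋆ weightedCount g) (suc n)
  ∎
  where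
  open ≡-Reasoning
  cw : ℕ → ℕ
  cw h = sumWords n (cutWeight g h)
  mw : Step → ℕ
  mw s = sumWords n (λ w → motzkinWeight g (s ∷ w))
  regroup : ∀ a b c d e → (a + b) + c + (d + e) ≡ (b + c + e) + (a + d)
  regroup = solve-∀
sumWords-cutWeight g (suc n) (suc h) = begin
    sumWords (suc n) (cutWeight g (suc h))
  ≡⟨ sumWords-suc n (cutWeight g (suc h)) ⟩
    cw (suc (suc h)) + sumWords n (λ w → cutWeight g (suc h) (D ∷ w)) + cw (suc h)
  ≡⟨ cong (λ t → cw (suc (suc h)) + t + cw (suc h)) (sumWords-cong n (cutWeight-D g h)) ⟩
    cw (suc (suc h)) + cw h + cw (suc h)
  ≡⟨ cong₂ _+_ (cong₂ _+_ (sumWords-cutWeight g n (suc (suc h))) (sumWords-cutWeight g n h))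
               (sumWords-cutWeight g n (suc h)) ⟩
    (pathCount (suc (suc h)) ⋆ weightedCount g) n + (pathCount h ⋆ weightedCount g) n
      + (pathCount (suc h) ⋆ weightedCount g) n
  ≡⟨ cong (_+ (pathCount (suc h) ⋆ weightedCount g) n)
          (sym (⋆-distribʳ-+ (pathCount (suc (suc h))) (pathCount h) (weightedCount g) n)) ⟩
    ((λ i → pathCount (suc (suc h)) i + pathCount h i) ⋆ weightedCount g) n
      + (pathCount (suc h) ⋆ weightedCount g) n
  ≡⟨ sym (⋆-distribʳ-+ (λ i → pathCount (suc (suc h)) i + pathCount h i) (pathCount (suc h))
                       (weightedCount g) n) ⟩
    ((λ i → pathCount (suc (suc h)) i + pathCount h i + pathCount (suc h) i) ⋆ weightedCount g) n
  ≡⟨ ⋆-cong {b = weightedCount g} (λ i → sym (pathCount-suc h i)) (λ _ → refl) n ⟩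
    ((λ i → pathCount (suc h) (suc i)) ⋆ weightedCount g) n
  ≡⟨ sym (⋆-suc (pathCount (suc h)) (weightedCount g) n) ⟩
    (pathCount (suc h) ⋆ weightedCount g) (suc n)
  ∎
  where
  open ≡-Reasoning
  cw : ℕ → ℕ
  cw h = sumWords n (cutWeight g h)

-- At r = j = 0 the truncated subtraction yields 0 C 0 = 1, the intended value of C(-1, 0).
multichoose : ℕ → ℕ → ℕ
multichoose r j = (r + j ∸ 1) C j

multichoose-zero : ∀ j → multichoose 0 (suc j) ≡ 0
multichoose-zero j = k>n⇒nCk≡0 (n<1+n j)

partialSum-multichoose : ∀ r j → partialSum (multichoose r) (suc j) ≡ multichoose (suc r) j
partialSum-multichoose r zero    = refl
partialSum-multichoose r (suc j) = begin
    partialSum (multichoose r) (suc j) + multichoose r (suc j)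
  ≡⟨ cong (_+ multichoose r (suc j)) (partialSum-multichoose r j) ⟩
    (r + j) C j + (r + suc j ∸ 1) C suc j
  ≡⟨ cong (λ m → (r + j) C j + (m ∸ 1) C suc j) (+-suc r j) ⟩
    (r + j) C j + (r + j) C suc j
  ≡⟨ nCk+nC[k+1]≡[n+1]C[k+1] (r + j) j ⟩
    suc (r + j) C suc j
  ≡⟨ cong (_C suc j) (sym (+-suc r j)) ⟩
    multichoose (suc r) (suc j)
  ∎
  where open ≡-Reasoning

weightedCount-multichoose-zero : ∀ n → weightedCount (multichoose 0) (suc n) ≡ 0
weightedCount-multichoose-zero n =
  trans (sumWords-suc n _) (cong₂ _+_ (cong₂ _+_ (vanish U) (vanish D)) (vanish H))
  where
  weight-vanishes : ∀ s w → motzkinWeight (multichoose 0) (s ∷ w) ≡ 0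
  weight-vanishes s w with validFrom zero (s ∷ w) in valid
  ... | false = refl
  ... | true with returns-nonempty zero s w valid
  ...   | j , returns≡suc rewrite returns≡suc = multichoose-zero j
  vanish : ∀ s → sumWords n (λ w → motzkinWeight (multichoose 0) (s ∷ w)) ≡ 0
  vanish s = trans (sumWords-cong n (weight-vanishes s)) (sum-map-zero (words n))

cutWeight-multichoose : ∀ r w →
                        cutWeight (multichoose r) zero w ≡ motzkinWeight (multichoose (suc r)) w
cutWeight-multichoose r w with validFrom zero w
... | true  = partialSum-multichoose r (returns zero w)
... | false = refl

MotR≡weightedCount : ∀ r n → MotR r n ≡ weightedCount (multichoose r) n
MotR≡weightedCount zero    zero    = refl
MotR≡weightedCount zero    (suc n) = sym (weightedCount-multichoose-zero n)
MotR≡weightedCount (suc r) n       = begin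
    (motNum ⋆ MotR r) n
  ≡⟨ ⋆-cong motNum≡pathCount (MotR≡weightedCount r) n ⟩
    (pathCount zero ⋆ weightedCount (multichoose r)) n
  ≡⟨ sym (sumWords-cutWeight (multichoose r) n zero) ⟩
    sumWords n (cutWeight (multichoose r) zero)
  ≡⟨ sumWords-cong n (cutWeight-multichoose r) ⟩
    weightedCount (multichoose (suc r)) n
  ∎
  where open ≡-Reasoning

rhs≡weightedCount : ∀ r n → rhs r n ≡ weightedCount (multichoose r) n
rhs≡weightedCount r n =
  trans (sum-map-filterᵇ isMotzkin (λ w → multichoose r (k w)) (words n)) (sumWords-cong n weight)
  where
  weight : ∀ w → (if isMotzkin w then multichoose r (k w) else 0) ≡ motzkinWeight (multichoose r) w
  weight w with isMotzkin w in motzkin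
  ... | true  = cong (multichoose r) (k≡returns w motzkin)
  ... | false = refl

mainTheorem2 : (r n : ℕ) → MotR r n ≡ rhs r n
mainTheorem2 r n = trans (MotR≡weightedCount r n) (sym (rhs≡weightedCount r n))
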